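{- Let $D=(V_1,V_2;A)$ be a 2-arc-strong split digraph. Suppose that at least one of the following holds: (1) there are distinct vertices $x_1,x_2,u\in V(D)$ and vertices $x_3,v\in V(D)\setminus\{x_1,x_2,u\}$ (possibly $x_3=v$) such that $N_D^+(u)=\{x_1,x_3\}$, $N_D^-(u)=\{x_1,x_2\}$, $N_D^+(x_1)=\{x_2,u\}$ and $N_D^+(x_2)=\{v,u\}$; (2) there are distinct vertices $x_1,x_2,u\in V(D)$ and vertices $x_3,v\in V(D)\setminus\{x_1,x_2,u\}$ (possibly $x_3=v$) such that $N_D^-(u)=\{x_1,x_3\}$, $N_D^+(u)=\{x_1,x_2\}$, $N_D^-(x_1)=\{x_2,u\}$ and $N_D^-(x_2)=\{v,u\}$. Then $D$ has no strong arc decomposition.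
   Context: A split digraph $D=(V_1,V_2;A)$ is a digraph whose vertex set is partitioned into an independent set $V_1$ and a set $V_2$ inducing a semicomplete digraph (every two distinct vertices of $V_2$ are joined by at least one arc). A digraph is strong if every vertex can reach every other by a directed path; it is 2-arc-strong if it stays strong after deleting any single arc. A strong arc decomposition of $D$ is a partition of $A$ into disjoint sets $A_1,A_2$ such that both spanning subdigraphs $(V(D),A_1)$ and $(V(D),A_2)$ are strong. $N_D^+(w)$ and $N_D^-(w)$ denote the sets of out-neighbours and in-neighbours of $w$ in $D$. -}

module Defs where

open import Data.Nat using (ℕ)
open import Data.Fin using (Fin; _≟_)
import Data.Bool
open import Relation.Nullary.Decidable using (⌊_⌋)
open import Data.Bool using (Bool; true; false; _∧_; not)
open import Data.Product using (_×_; Σ; ∃; _,_)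
open import Data.Sum using (_⊎_)
open import Relation.Binary.PropositionalEquality using (_≡_; _≢_)
open import Relation.Nullary using (¬_)
open import Function.Bundles using (_⇔_)

-- A (finite, loopless, simple) digraph on the vertex set Fin n,
-- given by its arc relation: arc u v ≡ true iff (u,v) is an arc.
record Digraph (n : ℕ) : Set where
  field
    arc      : Fin n → Fin n → Bool
    loopless : ∀ v → arc v v ≡ false
open Digraph public

-- An arc set (a spanning subdigraph) is a Boolean predicate on ordered pairs.
ArcSet : ℕ → Set
ArcSet n = Fin n → Fin n → Bool

data Reach {n : ℕ} (S : ArcSet n) : Fin n → Fin n → Set where
  here : ∀ {u} → Reach S u u
  step : ∀ {u w v} → S u w ≡ true → Reach S w v → Reach S u v

StrongArcs : {n : ℕ} → ArcSet n → Set
StrongArcs S = ∀ u v → Reach S u v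

Strong : {n : ℕ} → Digraph n → Set
Strong D = StrongArcs (arc D)

deleteArc : {n : ℕ} → ArcSet n → Fin n → Fin n → ArcSet n
deleteArc S a b x y = S x y ∧ not (⌊ x ≟ a ⌋ ∧ ⌊ y ≟ b ⌋)

TwoArcStrong : {n : ℕ} → Digraph n → Set
TwoArcStrong D = ∀ a b → arc D a b ≡ true → StrongArcs (deleteArc (arc D) a b)

-- Split digraph with partition (V₁, V₂): inV₁ v ≡ true iff v ∈ V₁, otherwise v ∈ V₂.
-- V₁ is independent and V₂ induces a semicomplete digraph.
IsSplit : {n : ℕ} → Digraph n → (Fin n → Bool) → Set
IsSplit D inV₁ =
  (∀ u v → inV₁ u ≡ true → inV₁ v ≡ true → arc D u v ≡ false)
  × (∀ u v → inV₁ u ≡ false → inV₁ v ≡ false → u ≢ v →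
       (arc D u v ≡ true ⊎ arc D v u ≡ true))

colourClass : {n : ℕ} → Digraph n → (Fin n → Fin n → Bool) → Bool → ArcSet n
colourClass D col c x y = arc D x y ∧ ⌊ col x y Data.Bool.≟ c ⌋

-- A strong arc decomposition: a partition of A into A₁ (colour true) and
-- A₂ (colour false), both spanning subdigraphs strong.
HasStrongArcDecomposition : {n : ℕ} → Digraph n → Set
HasStrongArcDecomposition {n} D =
  Σ (Fin n → Fin n → Bool) λ col →
    StrongArcs (colourClass D col true) × StrongArcs (colourClass D col false)

OutNbhd≡ : {n : ℕ} → Digraph n → Fin n → Fin n → Fin n → Set
OutNbhd≡ D u a b = ∀ w → (arc D u w ≡ true) ⇔ (w ≡ a ⊎ w ≡ b)

InNbhd≡ : {n : ℕ} → Digraph n → Fin n → Fin n → Fin n → Set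
InNbhd≡ D u a b = ∀ w → (arc D w u ≡ true) ⇔ (w ≡ a ⊎ w ≡ b)

Config : {n : ℕ} → Fin n → Fin n → Fin n → Fin n → Fin n → Set
Config x₁ x₂ x₃ u v =
  x₁ ≢ x₂ × x₁ ≢ u × x₂ ≢ u
  × (x₃ ≢ x₁ × x₃ ≢ x₂ × x₃ ≢ u)
  × (v ≢ x₁ × v ≢ x₂ × v ≢ u)

Condition1 : {n : ℕ} → Digraph n → Set
Condition1 {n} D = Σ (Fin n) λ x₁ → Σ (Fin n) λ x₂ → Σ (Fin n) λ x₃ →
  Σ (Fin n) λ u → Σ (Fin n) λ v →
    Config x₁ x₂ x₃ u v
    × OutNbhd≡ D u x₁ x₃ × InNbhd≡ D u x₁ x₂
    × OutNbhd≡ D x₁ x₂ u × OutNbhd≡ D x₂ v u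

Condition2 : {n : ℕ} → Digraph n → Set
Condition2 {n} D = Σ (Fin n) λ x₁ → Σ (Fin n) λ x₂ → Σ (Fin n) λ x₃ →
  Σ (Fin n) λ u → Σ (Fin n) λ v →
    Config x₁ x₂ x₃ u v
    × InNbhd≡ D u x₁ x₃ × OutNbhd≡ D u x₁ x₂
    × InNbhd≡ D x₁ x₂ u × InNbhd≡ D x₂ v u

-- Let c be the colour of x₁u and c̄ the other colour.  As u is entered only
-- from x₁ and x₂, the c̄-class needs x₂u; as x₁ leaves only to x₂ and u, it
-- needs x₁x₂.  So the c-class must leave x₂ by x₂v, and must leave {x₁, u} by
-- ux₃.  Every arc leaving {x₁, x₂, u} is then x₁u, x₂v or ux₃, all of colour c,
-- so the c̄-class never reaches v.  Condition (2) is condition (1) in the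
-- reverse digraph.
module Submission where

open import Defs
open import Data.Nat using (ℕ)
open import Data.Fin using (Fin)
open import Data.Bool using (Bool; true; false; not; _≟_)
open import Data.Bool.Properties using (∧-conicalˡ; ∧-conicalʳ; T-≡; not-¬)
open import Data.Sum using (_⊎_; inj₁; inj₂)
open import Data.Product using (_×_; _,_)
open import Data.Empty using (⊥; ⊥-elim)
open import Function using (flip; _∘_)
open import Function.Bundles using (Equivalence)
open import Relation.Nullary using (¬_)
open import Relation.Nullary.Decidable using (toWitness)
open import Relation.Binary.PropositionalEquality using (_≡_; refl; sym; _≢_)

Closed : {n : ℕ} → ArcSet n → (Fin n → Set) → Set
Closed S P = ∀ {x y} → S x y ≡ true → P x → P y

Reach-closed : {n : ℕ} {S : ArcSet n} {P : Fin n → Set} → Closed S P →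
  ∀ {a b} → Reach S a b → P a → P b
Reach-closed cl here       p = p
Reach-closed cl (step s r) p = Reach-closed cl r (cl s p)

Reach-from-sink : {n : ℕ} {S : ArcSet n} {a b : Fin n} →
  (∀ {y} → S a y ≡ true → ⊥) → Reach S a b → a ≡ b
Reach-from-sink noOut here       = refl
Reach-from-sink noOut (step s _) = ⊥-elim (noOut s)

Reach-snoc : {n : ℕ} {S : ArcSet n} {a w b : Fin n} →
  Reach S a w → S w b ≡ true → Reach S a b
Reach-snoc here       s = step s here
Reach-snoc (step t r) s = step t (Reach-snoc r s)

Reach-reverse : {n : ℕ} {S : ArcSet n} {a b : Fin n} →
  Reach S a b → Reach (flip S) b a
Reach-reverse here       = here
Reach-reverse (step s r) = Reach-snoc (Reach-reverse r) s

reverse : {n : ℕ} → Digraph n → Digraph n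
reverse D = record { arc = flip (arc D) ; loopless = loopless D }

reverse-hasStrongArcDecomposition : {n : ℕ} (D : Digraph n) →
  HasStrongArcDecomposition D → HasStrongArcDecomposition (reverse D)
reverse-hasStrongArcDecomposition D (col , s₁ , s₂) =
  flip col , (λ a b → Reach-reverse (s₁ b a)) , (λ a b → Reach-reverse (s₂ b a))

condition2⇒reverse-condition1 : {n : ℕ} (D : Digraph n) →
  Condition2 D → Condition1 (reverse D)
condition2⇒reverse-condition1 D c = c

module _ {n : ℕ} (D : Digraph n) (col : Fin n → Fin n → Bool) where

  colourClass-arc : ∀ {d x y} → colourClass D col d x y ≡ true →
    arc D x y ≡ true × col x y ≡ d
  colourClass-arc {d} {x} {y} h =
    ∧-conicalˡ (arc D x y) _ h ,
    toWitness {a? = col x y ≟ d}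
      (Equivalence.from T-≡ (∧-conicalʳ (arc D x y) _ h))

  colourClass-out : ∀ {d w a b y} → OutNbhd≡ D w a b →
    colourClass D col d w y ≡ true →
    (y ≡ a × col w a ≡ d) ⊎ (y ≡ b × col w b ≡ d)
  colourClass-out {y = y} out h with colourClass-arc h
  ... | wy , colour with Equivalence.to (out y) wy
  ... | inj₁ refl = inj₁ (refl , colour)
  ... | inj₂ refl = inj₂ (refl , colour)


colourClass-in : {n : ℕ} (D : Digraph n) (col : Fin n → Fin n → Bool) →
  ∀ {d w a b x} → InNbhd≡ D w a b → colourClass D col d x w ≡ true →
  (x ≡ a × col a w ≡ d) ⊎ (x ≡ b × col b w ≡ d)
colourClass-in D col = colourClass-out (reverse D) (flip col)

module Condition1Colouring {n : ℕ} (D : Digraph n) (col : Fin n → Fin n → Bool)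
  {c : Bool} {x₁ x₂ x₃ u v : Fin n}
  (x₁≢x₂ : x₁ ≢ x₂) (x₁≢u : x₁ ≢ u) (x₂≢u : x₂ ≢ u)
  (v≢x₁ : v ≢ x₁) (v≢x₂ : v ≢ x₂) (v≢u : v ≢ u)
  (outU : OutNbhd≡ D u x₁ x₃) (inU : InNbhd≡ D u x₁ x₂)
  (outX₁ : OutNbhd≡ D x₁ x₂ u) (outX₂ : OutNbhd≡ D x₂ v u)
  (x₁u : col x₁ u ≡ c)
  (strong : StrongArcs (colourClass D col c))
  (strong¬ : StrongArcs (colourClass D col (not c))) where

  x₁u≢¬c : col x₁ u ≢ not c
  x₁u≢¬c = not-¬ x₁u

  x₂u≢c : col x₂ u ≢ c
  x₂u≢c x₂u = Reach-closed u-unentered (strong¬ x₁ u) x₁≢u refl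
    where
    u-unentered : Closed (colourClass D col (not c)) (_≢ u)
    u-unentered s _ refl with colourClass-in D col inU s
    ... | inj₁ (refl , k) = x₁u≢¬c k
    ... | inj₂ (refl , k) = not-¬ x₂u k

  x₁x₂≢c : col x₁ x₂ ≢ c
  x₁x₂≢c x₁x₂ = x₁≢u (Reach-from-sink x₁-sink (strong¬ x₁ u))
    where
    x₁-sink : ∀ {y} → colourClass D col (not c) x₁ y ≡ true → ⊥
    x₁-sink s with colourClass-out D col outX₁ s
    ... | inj₁ (refl , k) = not-¬ x₁x₂ k
    ... | inj₂ (refl , k) = x₁u≢¬c k

  x₂v≢¬c : col x₂ v ≢ not c
  x₂v≢¬c x₂v = x₂≢u (Reach-from-sink x₂-sink (strong x₂ u))
    where
    x₂-sink : ∀ {y} → colourClass D col c x₂ y ≡ true → ⊥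
    x₂-sink s with colourClass-out D col outX₂ s
    ... | inj₁ (refl , k) = not-¬ k x₂v
    ... | inj₂ (refl , k) = x₂u≢c k

  x₁u-closed : col u x₃ ≡ not c →
    Closed (colourClass D col c) (λ w → w ≡ x₁ ⊎ w ≡ u)
  x₁u-closed ux₃ s (inj₁ refl) with colourClass-out D col outX₁ s
  ... | inj₁ (refl , k) = ⊥-elim (x₁x₂≢c k)
  ... | inj₂ (refl , _) = inj₂ refl
  x₁u-closed ux₃ s (inj₂ refl) with colourClass-out D col outU s
  ... | inj₁ (refl , _) = inj₁ refl
  ... | inj₂ (refl , k) = ⊥-elim (not-¬ k ux₃)

  ux₃≢¬c : col u x₃ ≢ not c
  ux₃≢¬c ux₃ with Reach-closed (x₁u-closed ux₃) (strong u x₂) (inj₂ refl)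
  ... | inj₁ x₂≡x₁ = x₁≢x₂ (sym x₂≡x₁)
  ... | inj₂ x₂≡u  = x₂≢u x₂≡u

  x₁x₂u-closed : Closed (colourClass D col (not c))
                        (λ w → w ≡ x₁ ⊎ w ≡ x₂ ⊎ w ≡ u)
  x₁x₂u-closed s (inj₁ refl) with colourClass-out D col outX₁ s
  ... | inj₁ (refl , _) = inj₂ (inj₁ refl)
  ... | inj₂ (refl , k) = ⊥-elim (x₁u≢¬c k)
  x₁x₂u-closed s (inj₂ (inj₁ refl)) with colourClass-out D col outX₂ s
  ... | inj₁ (refl , k) = ⊥-elim (x₂v≢¬c k)
  ... | inj₂ (refl , _) = inj₂ (inj₂ refl)
  x₁x₂u-closed s (inj₂ (inj₂ refl)) with colourClass-out D col outU s
  ... | inj₁ (refl , _) = inj₁ refl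
  ... | inj₂ (refl , k) = ⊥-elim (ux₃≢¬c k)

  contradiction : ⊥
  contradiction with Reach-closed x₁x₂u-closed (strong¬ x₁ v) (inj₁ refl)
  ... | inj₁ v≡x₁        = v≢x₁ v≡x₁
  ... | inj₂ (inj₁ v≡x₂) = v≢x₂ v≡x₂
  ... | inj₂ (inj₂ v≡u)  = v≢u v≡u

condition1⇒¬hasStrongArcDecomposition : {n : ℕ} (D : Digraph n) →
  Condition1 D → ¬ HasStrongArcDecomposition D
condition1⇒¬hasStrongArcDecomposition D
  (x₁ , _ , _ , u , _ , (x₁≢x₂ , x₁≢u , x₂≢u , _ , v≢x₁ , v≢x₂ , v≢u) ,
   outU , inU , outX₁ , outX₂)
  (col , strongᵀ , strongᶠ) with col x₁ u in x₁u
... | true  = Condition1Colouring.contradiction D col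
                x₁≢x₂ x₁≢u x₂≢u v≢x₁ v≢x₂ v≢u
                outU inU outX₁ outX₂ x₁u strongᵀ strongᶠ
... | false = Condition1Colouring.contradiction D col
                x₁≢x₂ x₁≢u x₂≢u v≢x₁ v≢x₂ v≢u
                outU inU outX₁ outX₂ x₁u strongᶠ strongᵀ

lemma2p4 : {n : ℕ} (D : Digraph n) (inV₁ : Fin n → Bool) →
    IsSplit D inV₁ → TwoArcStrong D →
    Condition1 D ⊎ Condition2 D →
    ¬ HasStrongArcDecomposition D
lemma2p4 D _ _ _ (inj₁ cond₁) =
  condition1⇒¬hasStrongArcDecomposition D cond₁
lemma2p4 D _ _ _ (inj₂ cond₂) =
  condition1⇒¬hasStrongArcDecomposition (reverse D)
    (condition2⇒reverse-condition1 D cond₂)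
    ∘ reverse-hasStrongArcDecomposition D
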